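{- $\mathbf{CLA4}$ proves $\sqcap x\sqcup y\,(x=y0\ \sqcup\ x=y1)$, where $y0$ abbreviates $0''\times y$ and $y1$ abbreviates $(0''\times y)'$.
   Context: Language of $\mathbf{CLA4}$. Terms are built from variables, the constant $0$, unary $'$ (successor), binary $+$, $\times$; atomic formulas are $\tau_1=\tau_2$. Formulas are built from atoms with $\top,\bot$, $\neg$ (officially applied only to atoms; elsewhere via De Morgan laws and double negation), $\wedge,\vee$, choice connectives $\sqcap,\sqcup$, and quantifiers $\forall,\exists$ (blind) and $\sqcap x,\sqcup x$ (choice). $E\to F$ abbreviates $\neg E\vee F$. Elementary formulas are those without $\sqcap,\sqcup$ (formulas of Peano arithmetic $\mathbf{PA}$). $\tau 0$ abbreviates $0''\times\tau$ and $\tau1$ abbreviates $(0''\times\tau)'$. $|x|$ denotes the length $\lceil\log_2(x+1)\rceil$ of the binary numeral of $x$; expressions involving $|x|$ abbreviate standard $\mathbf{PA}$ formulas. A polynomial sizebound for $x$ is a $\mathbf{PA}$ formula expressing $|x|\le\tau(|y_1|,\ldots,|y_n|)$, with the $y_i$ variables other than $x$ and $\tau$ built from $0,',+,\times$. A formula is polynomially bounded iff each subformula $\sqcap xG(x)$ has $G(x)$ of the form $S(x)\to H(x)$ and each subformula $\sqcup xG(x)$ has $G(x)$ of the form $S(x)\wedge H(x)$, $S(x)$ a polynomial sizebound for $x$. The $\sqcap$-closure ($\forall$-closure) prefixes $\sqcap$ ($\forall$) over all free variables. Logic $\mathbf{CL12}$. A sequent is $E_1,\ldots,E_n\circ\!\!-F$.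 The elementarization $\|F\|$ replaces every $\sqcup$- and $\sqcup x$-subformula by $\bot$ and every $\sqcap$- and $\sqcap x$-subformula by $\top$; the elementarization of a sequent is $\|E_1\|\wedge\ldots\wedge\|E_n\|\to\|F\|$; a sequent is stable iff its elementarization is classically valid (first-order logic with identity). A surface occurrence is one not in the scope of a choice operator; $F[E]$ denotes a formula with a fixed surface occurrence of $E$. Rules ($i\in\{0,1\}$; $\mathfrak t$ a constant or a variable not bound in the premise): $\sqcup$-Choose: $\vec G\circ\!\!-F[H_i]\,/\,\vec G\circ\!\!-F[H_0\sqcup H_1]$; $\sqcap$-Choose: $\vec G,E[H_i],\vec K\circ\!\!-F\,/\,\vec G,E[H_0\sqcap H_1],\vec K\circ\!\!-F$; $\sqcup x$-Choose: $\vec G\circ\!\!-F[H(\mathfrak t)]\,/\,\vec G\circ\!\!-F[\sqcup xH(x)]$; $\sqcap x$-Choose: $\vec G,E[H(\mathfrak t)],\vec K\circ\!\!-F\,/\,\vec G,E[\sqcap xH(x)],\vec K\circ\!\!-F$; Replicate: $\vec G,E,\vec K,E\circ\!\!-F\,/\,\vec G,E,\vec K\circ\!\!-F$; Wait: from $Y_1,\ldots,Y_n$ ($n\ge0$) infer a stable $X$ provided: if $X$ is $\vec G\circ\!\!-F[H_0\sqcap H_1]$ then $\vec G\circ\!\!-F[H_0]$, $\vec G\circ\!\!-F[H_1]$ are among the $Y_j$; if $X$ is $\vec G,E[H_0\sqcup H_1],\vec K\circ\!\!-F$ then $\vec G,E[H_0],\vec K\circ\!\!-F$, $\vec G,E[H_1],\vec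 K\circ\!\!-F$ are among the $Y_j$; if $X$ is $\vec G\circ\!\!-F[\sqcap xH(x)]$ then $\vec G\circ\!\!-F[H(y)]$ is among the $Y_j$ for some $y$ not in $X$; if $X$ is $\vec G,E[\sqcup xH(x)],\vec K\circ\!\!-F$ then $\vec G,E[H(y)],\vec K\circ\!\!-F$ is among the $Y_j$ for some $y$ not in $X$. System $\mathbf{CLA4}$. Axioms: $\forall x(0\neq x')$; $\forall x\forall y(x'=y'\to x=y)$; $\forall x(x+0=x)$; $\forall x\forall y(x+y'=(x+y)')$; $\forall x(x\times0=0)$; $\forall x\forall y(x\times y'=(x\times y)+x)$; the $\forall$-closure of $F(0)\wedge\forall x(F(x)\to F(x'))\to\forall xF(x)$ for each elementary $F(x)$; $\sqcap x\sqcup y(y=x')$; $\sqcap x\sqcup y(y=x0)$. Rules: Logical Consequence (from sentences $E_1,\ldots,E_n$ infer a sentence $F$ whenever $\mathbf{CL12}$ proves $E_1,\ldots,E_n\circ\!\!-F$), and $\mathbf{CLA4}$-Induction: from the $\sqcap$-closures of $F(0)$, $F(x)\to F(x0)$, $F(x)\to F(x1)$ infer the $\sqcap$-closure of $F(x)$, for polynomially bounded $F(x)$. A sentence is provable in $\mathbf{CLA4}$ iff there is a finite sequence of sentences, each an axiom or obtained from earlier ones by a rule, ending with it. -}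

module Defs where

open import Data.Nat using (ℕ; zero; suc; _+_; _*_; _≤_; _≟_)
open import Data.Nat.Logarithm using (⌈log₂_⌉)
open import Data.Bool using (Bool; true; false)
open import Data.List using (List; []; _∷_; _++_; map; foldr; deduplicate)
open import Data.List.Membership.Propositional using (_∈_; _∉_)
open import Data.List.Relation.Unary.All using (All)
open import Data.Product using (Σ; _×_; _,_)
open import Data.Sum using (_⊎_)
open import Data.Unit using (⊤; tt)
open import Data.Empty using (⊥)
open import Relation.Nullary using (¬_; yes; no)
open import Relation.Binary.PropositionalEquality using (_≡_)

Var : Set
Var = ℕ

data Term : Set where
  var  : Var → Term
  zer  : Term
  sc   : Term → Term
  _⊕_  : Term → Term → Term
  _⊗_  : Term → Term → Term

-- Formulas; negation is applied only to atoms (the ≠ constructor)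
data Formula : Set where
  _≐_  : Term → Term → Formula
  _≠_  : Term → Term → Formula
  ⊤ᶠ   : Formula
  ⊥ᶠ   : Formula
  _∧ᶠ_ : Formula → Formula → Formula
  _∨ᶠ_ : Formula → Formula → Formula
  _⊓ᶜ_ : Formula → Formula → Formula
  _⊔ᶜ_ : Formula → Formula → Formula
  ∀ᶠ   : Var → Formula → Formula
  ∃ᶠ   : Var → Formula → Formula
  ⊓∀   : Var → Formula → Formula
  ⊔∃   : Var → Formula → Formula

neg : Formula → Formula
neg (s ≐ t)   = s ≠ t
neg (s ≠ t)   = s ≐ t
neg ⊤ᶠ        = ⊥ᶠ
neg ⊥ᶠ        = ⊤ᶠ
neg (A ∧ᶠ B)  = neg A ∨ᶠ neg B
neg (A ∨ᶠ B)  = neg A ∧ᶠ neg B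
neg (A ⊓ᶜ B)  = neg A ⊔ᶜ neg B
neg (A ⊔ᶜ B)  = neg A ⊓ᶜ neg B
neg (∀ᶠ x A)  = ∃ᶠ x (neg A)
neg (∃ᶠ x A)  = ∀ᶠ x (neg A)
neg (⊓∀ x A)  = ⊔∃ x (neg A)
neg (⊔∃ x A)  = ⊓∀ x (neg A)

_⇒ᶠ_ : Formula → Formula → Formula
E ⇒ᶠ F = neg E ∨ᶠ F

two : Term
two = sc (sc zer)

_·0 : Term → Term
τ ·0 = two ⊗ τ

_·1 : Term → Term
τ ·1 = sc (two ⊗ τ)

Elementary : Formula → Set
Elementary (_ ≐ _)   = ⊤
Elementary (_ ≠ _)   = ⊤
Elementary ⊤ᶠ        = ⊤
Elementary ⊥ᶠ        = ⊤
Elementary (A ∧ᶠ B)  = Elementary A × Elementary B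
Elementary (A ∨ᶠ B)  = Elementary A × Elementary B
Elementary (_ ⊓ᶜ _)  = ⊥
Elementary (_ ⊔ᶜ _)  = ⊥
Elementary (∀ᶠ _ A)  = Elementary A
Elementary (∃ᶠ _ A)  = Elementary A
Elementary (⊓∀ _ _)  = ⊥
Elementary (⊔∃ _ _)  = ⊥

varsT : Term → List Var
varsT (var x) = x ∷ []
varsT zer     = []
varsT (sc t)  = varsT t
varsT (s ⊕ t) = varsT s ++ varsT t
varsT (s ⊗ t) = varsT s ++ varsT t

remove : Var → List Var → List Var
remove x [] = []
remove x (y ∷ ys) with x ≟ y
... | yes _ = remove x ys
... | no  _ = y ∷ remove x ys

fv : Formula → List Var
fv (s ≐ t)  = varsT s ++ varsT t
fv (s ≠ t)  = varsT s ++ varsT t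
fv ⊤ᶠ       = []
fv ⊥ᶠ       = []
fv (A ∧ᶠ B) = fv A ++ fv B
fv (A ∨ᶠ B) = fv A ++ fv B
fv (A ⊓ᶜ B) = fv A ++ fv B
fv (A ⊔ᶜ B) = fv A ++ fv B
fv (∀ᶠ x A) = remove x (fv A)
fv (∃ᶠ x A) = remove x (fv A)
fv (⊓∀ x A) = remove x (fv A)
fv (⊔∃ x A) = remove x (fv A)

freeVars : Formula → List Var
freeVars F = deduplicate _≟_ (fv F)

Sentence : Formula → Set
Sentence F = fv F ≡ []

boundVars : Formula → List Var
boundVars (_ ≐ _)  = []
boundVars (_ ≠ _)  = []
boundVars ⊤ᶠ       = []
boundVars ⊥ᶠ       = []
boundVars (A ∧ᶠ B) = boundVars A ++ boundVars B
boundVars (A ∨ᶠ B) = boundVars A ++ boundVars B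
boundVars (A ⊓ᶜ B) = boundVars A ++ boundVars B
boundVars (A ⊔ᶜ B) = boundVars A ++ boundVars B
boundVars (∀ᶠ x A) = x ∷ boundVars A
boundVars (∃ᶠ x A) = x ∷ boundVars A
boundVars (⊓∀ x A) = x ∷ boundVars A
boundVars (⊔∃ x A) = x ∷ boundVars A

allVars : Formula → List Var
allVars (s ≐ t)  = varsT s ++ varsT t
allVars (s ≠ t)  = varsT s ++ varsT t
allVars ⊤ᶠ       = []
allVars ⊥ᶠ       = []
allVars (A ∧ᶠ B) = allVars A ++ allVars B
allVars (A ∨ᶠ B) = allVars A ++ allVars B
allVars (A ⊓ᶜ B) = allVars A ++ allVars B
allVars (A ⊔ᶜ B) = allVars A ++ allVars B
allVars (∀ᶠ x A) = x ∷ allVars A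
allVars (∃ᶠ x A) = x ∷ allVars A
allVars (⊓∀ x A) = x ∷ allVars A
allVars (⊔∃ x A) = x ∷ allVars A

substT : Var → Term → Term → Term
substT x t (var y) with x ≟ y
... | yes _ = t
... | no  _ = var y
substT x t zer     = zer
substT x t (sc s)  = sc (substT x t s)
substT x t (s ⊕ u) = substT x t s ⊕ substT x t u
substT x t (s ⊗ u) = substT x t s ⊗ substT x t u

subst : Var → Term → Formula → Formula
subst x t (s ≐ u)  = substT x t s ≐ substT x t u
subst x t (s ≠ u)  = substT x t s ≠ substT x t u
subst x t ⊤ᶠ       = ⊤ᶠ
subst x t ⊥ᶠ       = ⊥ᶠ
subst x t (A ∧ᶠ B) = subst x t A ∧ᶠ subst x t B
subst x t (A ∨ᶠ B) = subst x t A ∨ᶠ subst x t B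
subst x t (A ⊓ᶜ B) = subst x t A ⊓ᶜ subst x t B
subst x t (A ⊔ᶜ B) = subst x t A ⊔ᶜ subst x t B
subst x t (∀ᶠ y A) with x ≟ y
... | yes _ = ∀ᶠ y A
... | no  _ = ∀ᶠ y (subst x t A)
subst x t (∃ᶠ y A) with x ≟ y
... | yes _ = ∃ᶠ y A
... | no  _ = ∃ᶠ y (subst x t A)
subst x t (⊓∀ y A) with x ≟ y
... | yes _ = ⊓∀ y A
... | no  _ = ⊓∀ y (subst x t A)
subst x t (⊔∃ y A) with x ≟ y
... | yes _ = ⊔∃ y A
... | no  _ = ⊔∃ y (subst x t A)

∀-closure : Formula → Formula
∀-closure F = foldr ∀ᶠ F (freeVars F)

⊓-closure : Formula → Formula
⊓-closure F = foldr ⊓∀ F (freeVars F)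

-- Classical semantics (first-order logic with identity)
-- Truth is given by the Gödel–Gentzen negative translation, so that
-- validity in all structures is exactly classical validity.

record Structure : Set₁ where
  field
    D   : Set
    z   : D
    s   : D → D
    pl  : D → D → D
    ml  : D → D → D

module _ (M : Structure) where
  open Structure M

  evalT : (Var → D) → Term → D
  evalT ρ (var x) = ρ x
  evalT ρ zer     = z
  evalT ρ (sc t)  = s (evalT ρ t)
  evalT ρ (a ⊕ b) = pl (evalT ρ a) (evalT ρ b)
  evalT ρ (a ⊗ b) = ml (evalT ρ a) (evalT ρ b)

  update : (Var → D) → Var → D → (Var → D)
  update ρ x d y with x ≟ y
  ... | yes _ = d
  ... | no  _ = ρ y

  -- (choice operators only matter through elementarization; on
  --  elementary formulas this is the classical truth definition)
  ⟦_⟧ : Formula → (Var → D) → Set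
  ⟦ a ≐ b ⟧  ρ = ¬ ¬ (evalT ρ a ≡ evalT ρ b)
  ⟦ a ≠ b ⟧  ρ = ¬ (evalT ρ a ≡ evalT ρ b)
  ⟦ ⊤ᶠ ⟧     ρ = ⊤
  ⟦ ⊥ᶠ ⟧     ρ = ⊥
  ⟦ A ∧ᶠ B ⟧ ρ = ⟦ A ⟧ ρ × ⟦ B ⟧ ρ
  ⟦ A ∨ᶠ B ⟧ ρ = ¬ (¬ ⟦ A ⟧ ρ × ¬ ⟦ B ⟧ ρ)
  ⟦ A ⊓ᶜ B ⟧ ρ = ⊤
  ⟦ A ⊔ᶜ B ⟧ ρ = ⊥
  ⟦ ∀ᶠ x A ⟧ ρ = (d : D) → ⟦ A ⟧ (update ρ x d)
  ⟦ ∃ᶠ x A ⟧ ρ = ¬ ((d : D) → ¬ ⟦ A ⟧ (update ρ x d))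
  ⟦ ⊓∀ x A ⟧ ρ = ⊤
  ⟦ ⊔∃ x A ⟧ ρ = ⊥

Valid : Formula → Set₁
Valid F = (M : Structure) (ρ : Var → Structure.D M) → ⟦ M ⟧ F ρ

ℕ-model : Structure
ℕ-model = record { D = ℕ ; z = zero ; s = suc ; pl = _+_ ; ml = _*_ }

len : ℕ → ℕ
len x = ⌈log₂ (suc x) ⌉

-- S is a polynomial sizebound for x: an elementary (PA) formula
-- expressing |x| ≤ τ(|y₁|,…,|yₙ|), τ built from 0,',+,× over variables
-- y_i other than x (“expressing” = truth in the standard model).
SizeBound : Var → Formula → Set
SizeBound x S =
  Elementary S ×
  Σ Term λ τ → (x ∉ varsT τ) ×
    ((ρ : Var → ℕ) →
      (⟦ ℕ-model ⟧ S ρ → len (ρ x) ≤ evalT ℕ-model (λ v → len (ρ v)) τ) ×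
      (len (ρ x) ≤ evalT ℕ-model (λ v → len (ρ v)) τ → ⟦ ℕ-model ⟧ S ρ))

data PolyBounded : Formula → Set where
  pb-eq  : ∀ s t → PolyBounded (s ≐ t)
  pb-neq : ∀ s t → PolyBounded (s ≠ t)
  pb-⊤   : PolyBounded ⊤ᶠ
  pb-⊥   : PolyBounded ⊥ᶠ
  pb-∧   : ∀ {A B} → PolyBounded A → PolyBounded B → PolyBounded (A ∧ᶠ B)
  pb-∨   : ∀ {A B} → PolyBounded A → PolyBounded B → PolyBounded (A ∨ᶠ B)
  pb-⊓   : ∀ {A B} → PolyBounded A → PolyBounded B → PolyBounded (A ⊓ᶜ B)
  pb-⊔   : ∀ {A B} → PolyBounded A → PolyBounded B → PolyBounded (A ⊔ᶜ B)
  pb-∀   : ∀ {x A} → PolyBounded A → PolyBounded (∀ᶠ x A)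
  pb-∃   : ∀ {x A} → PolyBounded A → PolyBounded (∃ᶠ x A)
  pb-⊓x  : ∀ x G S H → G ≡ (S ⇒ᶠ H) → SizeBound x S → PolyBounded H →
           PolyBounded (⊓∀ x G)
  pb-⊔x  : ∀ x G S H → G ≡ (S ∧ᶠ H) → SizeBound x S → PolyBounded H →
           PolyBounded (⊔∃ x G)

record Sequent : Set where
  constructor _∘-_
  field
    ante : List Formula
    succ : Formula

-- contexts with a single surface hole (not in scope of a choice operator)
data Ctx : Set where
  hole : Ctx
  _∧ₗ_ : Ctx → Formula → Ctx
  _∧ᵣ_ : Formula → Ctx → Ctx
  _∨ₗ_ : Ctx → Formula → Ctx
  _∨ᵣ_ : Formula → Ctx → Ctx
  ∀ᶜ   : Var → Ctx → Ctx
  ∃ᶜ   : Var → Ctx → Ctx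

plug : Ctx → Formula → Formula
plug hole      E = E
plug (C ∧ₗ F)  E = plug C E ∧ᶠ F
plug (F ∧ᵣ C)  E = F ∧ᶠ plug C E
plug (C ∨ₗ F)  E = plug C E ∨ᶠ F
plug (F ∨ᵣ C)  E = F ∨ᶠ plug C E
plug (∀ᶜ x C)  E = ∀ᶠ x (plug C E)
plug (∃ᶜ x C)  E = ∃ᶠ x (plug C E)

∥_∥ : Formula → Formula
∥ s ≐ t ∥   = s ≐ t
∥ s ≠ t ∥   = s ≠ t
∥ ⊤ᶠ ∥      = ⊤ᶠ
∥ ⊥ᶠ ∥      = ⊥ᶠ
∥ A ∧ᶠ B ∥  = ∥ A ∥ ∧ᶠ ∥ B ∥
∥ A ∨ᶠ B ∥  = ∥ A ∥ ∨ᶠ ∥ B ∥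
∥ A ⊓ᶜ B ∥  = ⊤ᶠ
∥ A ⊔ᶜ B ∥  = ⊥ᶠ
∥ ∀ᶠ x A ∥  = ∀ᶠ x ∥ A ∥
∥ ∃ᶠ x A ∥  = ∃ᶠ x ∥ A ∥
∥ ⊓∀ x A ∥  = ⊤ᶠ
∥ ⊔∃ x A ∥  = ⊥ᶠ

conj : List Formula → Formula
conj []           = ⊤ᶠ
conj (E ∷ [])     = E
conj (E ∷ E′ ∷ Es) = E ∧ᶠ conj (E′ ∷ Es)

elemSeq : Sequent → Formula
elemSeq (Γ ∘- F) = conj (map ∥_∥ Γ) ⇒ᶠ ∥ F ∥

Stable : Sequent → Set₁
Stable X = Valid (elemSeq X)

seqVars : (Formula → List Var) → Sequent → List Var
seqVars f (Γ ∘- F) = foldr (λ E vs → f E ++ vs) (f F) Γ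

Admissible : Term → Sequent → Set
Admissible t X = (t ≡ zer) ⊎ Σ Var λ y → (t ≡ var y) × (y ∉ seqVars boundVars X)

pick : Bool → Formula → Formula → Formula
pick false H₀ H₁ = H₀
pick true  H₀ H₁ = H₁

data CL12 : Sequent → Set₁ where
  ⊔-choose : ∀ Γ C H₀ H₁ i →
    CL12 (Γ ∘- plug C (pick i H₀ H₁)) → CL12 (Γ ∘- plug C (H₀ ⊔ᶜ H₁))
  ⊓-choose : ∀ G K C H₀ H₁ i F →
    CL12 ((G ++ plug C (pick i H₀ H₁) ∷ K) ∘- F) →
    CL12 ((G ++ plug C (H₀ ⊓ᶜ H₁) ∷ K) ∘- F)
  ⊔x-choose : ∀ Γ C x H t →
    Admissible t (Γ ∘- plug C (subst x t H)) →
    CL12 (Γ ∘- plug C (subst x t H)) → CL12 (Γ ∘- plug C (⊔∃ x H))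
  ⊓x-choose : ∀ G K C x H t F →
    Admissible t ((G ++ plug C (subst x t H) ∷ K) ∘- F) →
    CL12 ((G ++ plug C (subst x t H) ∷ K) ∘- F) →
    CL12 ((G ++ plug C (⊓∀ x H) ∷ K) ∘- F)
  replicate : ∀ G E K F →
    CL12 ((G ++ E ∷ K ++ E ∷ []) ∘- F) → CL12 ((G ++ E ∷ K) ∘- F)
  wait : ∀ Γ F →
    Stable (Γ ∘- F) →
    (∀ C H₀ H₁ → F ≡ plug C (H₀ ⊓ᶜ H₁) →
       CL12 (Γ ∘- plug C H₀) × CL12 (Γ ∘- plug C H₁)) →
    (∀ G K C H₀ H₁ → Γ ≡ G ++ plug C (H₀ ⊔ᶜ H₁) ∷ K →
       CL12 ((G ++ plug C H₀ ∷ K) ∘- F) × CL12 ((G ++ plug C H₁ ∷ K) ∘- F)) →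
    (∀ C x H → F ≡ plug C (⊓∀ x H) →
       Σ Var λ y → (y ∉ seqVars allVars (Γ ∘- F)) ×
         CL12 (Γ ∘- plug C (subst x (var y) H))) →
    (∀ G K C x H → Γ ≡ G ++ plug C (⊔∃ x H) ∷ K →
       Σ Var λ y → (y ∉ seqVars allVars (Γ ∘- F)) ×
         CL12 ((G ++ plug C (subst x (var y) H) ∷ K) ∘- F)) →
    CL12 (Γ ∘- F)

private
  v0 v1 : Term
  v0 = var 0
  v1 = var 1

inductionFormula : Var → Formula → Formula
inductionFormula x F =
  (subst x zer F ∧ᶠ ∀ᶠ x (F ⇒ᶠ subst x (sc (var x)) F)) ⇒ᶠ ∀ᶠ x F

data Axiom : Formula → Set where
  ax1 : Axiom (∀ᶠ 0 (zer ≠ sc v0))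
  ax2 : Axiom (∀ᶠ 0 (∀ᶠ 1 ((sc v0 ≐ sc v1) ⇒ᶠ (v0 ≐ v1))))
  ax3 : Axiom (∀ᶠ 0 ((v0 ⊕ zer) ≐ v0))
  ax4 : Axiom (∀ᶠ 0 (∀ᶠ 1 ((v0 ⊕ sc v1) ≐ sc (v0 ⊕ v1))))
  ax5 : Axiom (∀ᶠ 0 ((v0 ⊗ zer) ≐ zer))
  ax6 : Axiom (∀ᶠ 0 (∀ᶠ 1 ((v0 ⊗ sc v1) ≐ ((v0 ⊗ v1) ⊕ v0))))
  ax-ind : ∀ x F → Elementary F → Axiom (∀-closure (inductionFormula x F))
  ax-succ : Axiom (⊓∀ 0 (⊔∃ 1 (v1 ≐ sc v0)))
  ax-dbl  : Axiom (⊓∀ 0 (⊔∃ 1 (v1 ≐ (v0 ·0))))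

data CLA4⊢ : Formula → Set₁ where
  axiom : ∀ {F} → Axiom F → CLA4⊢ F
  logical-consequence : ∀ (Es : List Formula) F →
    All CLA4⊢ Es → Sentence F → CL12 (Es ∘- F) → CLA4⊢ F
  cla4-induction : ∀ x F → PolyBounded F →
    CLA4⊢ (⊓-closure (subst x zer F)) →
    CLA4⊢ (⊓-closure (F ⇒ᶠ subst x ((var x) ·0) F)) →
    CLA4⊢ (⊓-closure (F ⇒ᶠ subst x ((var x) ·1) F)) →
    CLA4⊢ (⊓-closure F)

-- Use CLA4-Induction on x with
--   F(x) = ⊔y (|y| ≤ |x| ∧ (x = y0 ⊔ x = y1)).
-- The conjunct |y| ≤ |x| is the polynomial sizebound the induction rule requires; in PA it
-- says that no power of two lies in (x, y]. In the base case y = 0 works, and both steps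
-- F(x) → F(xi) ignore their hypothesis and answer y = x. Dropping the sizebound from
-- ⊓x F(x) gives the theorem. The CL12 derivations are routine; the real content is that the
-- PA formula for |y| ≤ |x| means what it should in the standard model.

module Submission where

open import Defs
open import Data.Bool using (false; true)
open import Data.Empty using (⊥; ⊥-elim)
open import Data.List using (List; []; _∷_; _++_; map)
open import Data.List.Membership.Propositional using (_∈_; _∉_)
open import Data.List.Membership.Propositional.Properties using (∈-map⁺; ∈-++⁺ˡ; ∈-++⁺ʳ)
open import Data.List.Properties using (∷-injectiveʳ)
open import Data.List.Relation.Unary.All using (All; []; _∷_; lookup)
open import Data.List.Relation.Unary.All.Properties using (map⁺)
open import Data.List.Relation.Unary.Any using (here)
open import Data.Nat
  using (ℕ; zero; suc; _+_; _*_; _^_; _≤_; _<_; _≤?_; _≟_; z≤n; s≤s; ⌈_/2⌉; NonZero)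
open import Data.Nat.Coprimality using (Coprime; coprime-divisor)
open import Data.Nat.Divisibility
open import Data.Nat.Induction using (<-wellFounded)
open import Data.Nat.Logarithm using (⌈log₂⌉-mono-≤; ⌈log₂2^n⌉≡n)
open import Data.Nat.Logarithm.Core using (⌈log2⌉)
open import Data.Nat.Primality using (Prime; prime⇒irreducible; prime⇒nonTrivial; prime[2])
open import Data.Nat.Properties
open import Data.List.Membership.DecPropositional _≟_ using (_∈?_)
open import Data.Product using (Σ; ∃; ∃-syntax; _×_; _,_; map₁)
open import Data.Sum using (_⊎_; inj₁; inj₂; [_,_]′)
open import Data.Unit.Polymorphic using (⊤)
open import Function.Base using (_∘_)
open import Function.Bundles using (_⇔_; mk⇔; Equivalence)
open import Induction.WellFounded using (Acc; acc)
open import Relation.Nullary using (¬_; Dec; yes; no; contradiction)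
open import Relation.Nullary.Decidable using (False; toWitnessFalse; decidable-stable; _⊎-dec_)
open import Relation.Binary.PropositionalEquality using (_≡_; _≢_; refl; sym; trans; cong)
  renaming (subst to transport)

open Equivalence using (to; from)

-- Divisors of prime powers

DivisorsAre1OrMultiplesOf : ℕ → ℕ → Set
DivisorsAre1OrMultiplesOf p n = ∀ {d} → d ∣ n → d ≡ 1 ⊎ p ∣ d

¬∣⇒coprime : ∀ {p n} → Prime p → ¬ p ∣ n → Coprime n p
¬∣⇒coprime pr p∤n (c∣n , c∣p) with prime⇒irreducible pr c∣p
... | inj₁ c≡1  = c≡1
... | inj₂ refl = contradiction c∣n p∤n

power⇒divisorsAre1OrMultiples : ∀ {p} → Prime p → ∀ k → DivisorsAre1OrMultiplesOf p (p ^ k)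
power⇒divisorsAre1OrMultiples pr zero d∣1 = inj₁ (∣1⇒≡1 d∣1)
power⇒divisorsAre1OrMultiples {p} pr (suc k) {d} d∣p*p^k with p ∣? d
... | yes p∣d = inj₂ p∣d
... | no  p∤d = power⇒divisorsAre1OrMultiples pr k (coprime-divisor (¬∣⇒coprime pr p∤d) d∣p*p^k)

divisorsAre1OrMultiples⇒power : ∀ {p} → Prime p → ∀ n .{{_ : NonZero n}} →
  DivisorsAre1OrMultiplesOf p n → ∃[ k ] n ≡ p ^ k
divisorsAre1OrMultiples⇒power {p} pr n = go n (<-wellFounded n)
  where
  instance _ = prime⇒nonTrivial pr
  go : ∀ n .{{_ : NonZero n}} → Acc _<_ n → DivisorsAre1OrMultiplesOf p n → ∃[ k ] n ≡ p ^ k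
  go n (acc rec) divs with divs ∣-refl
  ... | inj₁ n≡1 = 0 , n≡1
  ... | inj₂ p∣n = let instance _ = quotient≢0 p∣n
                       k , q≡p^k = go (quotient p∣n) (rec (quotient-< p∣n))
                                      (λ d∣q → divs (∣-trans d∣q (quotient-∣ p∣n)))
                   in suc k , trans (m∣n⇒n≡m*quotient p∣n) (cong (p *_) q≡p^k)

-- Binary length

n≤2*⌈n/2⌉ : ∀ n → n ≤ 2 * ⌈ n /2⌉
n≤2*⌈n/2⌉ zero          = z≤n
n≤2*⌈n/2⌉ (suc zero)    = s≤s z≤n
n≤2*⌈n/2⌉ (suc (suc n)) rewrite *-suc 2 ⌈ n /2⌉ = s≤s (s≤s (n≤2*⌈n/2⌉ n))

n≤2^⌈log2⌉n : ∀ n acc → n ≤ 2 ^ ⌈log2⌉ n acc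
n≤2^⌈log2⌉n zero          _         = z≤n
n≤2^⌈log2⌉n (suc zero)    _         = s≤s z≤n
n≤2^⌈log2⌉n (suc (suc n)) (acc rec) =
  ≤-trans (n≤2*⌈n/2⌉ (suc (suc n))) (*-monoʳ-≤ 2 (n≤2^⌈log2⌉n (suc ⌈ n /2⌉) _))

<2^len : ∀ x → x < 2 ^ len x
<2^len x = n≤2^⌈log2⌉n (suc x) _

<2^⇒len≤ : ∀ {x} k → x < 2 ^ k → len x ≤ k
<2^⇒len≤ k x<2^k = transport (_ ≤_) (⌈log₂2^n⌉≡n k) (⌈log₂⌉-mono-≤ x<2^k)

len-mono : ∀ {x y} → x ≤ y → len x ≤ len y
len-mono x≤y = ⌈log₂⌉-mono-≤ (s≤s x≤y)

len≤len⇔noPowerOf2Between : ∀ x y →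
  len y ≤ len x ⇔ (∀ p → DivisorsAre1OrMultiplesOf 2 p → p ≤ x ⊎ suc y ≤ p)
len≤len⇔noPowerOf2Between x y = mk⇔ bounded⇒avoids avoids⇒bounded
  where
  bounded⇒avoids : len y ≤ len x → ∀ p → DivisorsAre1OrMultiplesOf 2 p → p ≤ x ⊎ suc y ≤ p
  bounded⇒avoids _ zero _ = inj₁ z≤n
  bounded⇒avoids ∣y∣≤∣x∣ p@(suc _) divs
    with divisorsAre1OrMultiples⇒power prime[2] p divs | p ≤? x
  ... | _ , _     | yes p≤x = inj₁ p≤x
  ... | k , p≡2^k | no  p≰x = inj₂ (transport (suc y ≤_) (sym p≡2^k) (begin-strict
    y              <⟨ <2^len y ⟩
    2 ^ len y      ≤⟨ ^-monoʳ-≤ 2 ∣y∣≤∣x∣ ⟩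
    2 ^ len x      ≤⟨ ^-monoʳ-≤ 2 (<2^⇒len≤ k (transport (x <_) p≡2^k (≰⇒> p≰x))) ⟩
    2 ^ k          ∎))
    where open ≤-Reasoning

  avoids⇒bounded : (∀ p → DivisorsAre1OrMultiplesOf 2 p → p ≤ x ⊎ suc y ≤ p) → len y ≤ len x
  avoids⇒bounded avoid =
    [ (λ 2^∣x∣≤x → contradiction (<2^len x) (≤⇒≯ 2^∣x∣≤x)) , <2^⇒len≤ (len x) ]′
      (avoid (2 ^ len x) (power⇒divisorsAre1OrMultiples prime[2] (len x)))

module Semantics (M : Structure) where

  ⟦⟧-stable : ∀ A ρ → ¬ ¬ ⟦ M ⟧ A ρ → ⟦ M ⟧ A ρ
  ⟦⟧-stable (s ≐ t)  ρ ¬¬a = λ ¬e → ¬¬a (λ ¬¬e → ¬¬e ¬e)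
  ⟦⟧-stable (s ≠ t)  ρ ¬¬a = λ e → ¬¬a (λ ¬e → ¬e e)
  ⟦⟧-stable ⊤ᶠ       ρ ¬¬a = _
  ⟦⟧-stable ⊥ᶠ       ρ ¬¬a = ¬¬a (λ ())
  ⟦⟧-stable (A ∧ᶠ B) ρ ¬¬a =
    ⟦⟧-stable A ρ (λ ¬a → ¬¬a (λ (a , _) → ¬a a)) , ⟦⟧-stable B ρ (λ ¬b → ¬¬a (λ (_ , b) → ¬b b))
  ⟦⟧-stable (A ∨ᶠ B) ρ ¬¬a = λ ¬a¬b → ¬¬a (λ a → a ¬a¬b)
  ⟦⟧-stable (A ⊓ᶜ B) ρ ¬¬a = _
  ⟦⟧-stable (A ⊔ᶜ B) ρ ¬¬a = ¬¬a (λ ())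
  ⟦⟧-stable (∀ᶠ x A) ρ ¬¬a = λ d → ⟦⟧-stable A (update M ρ x d) (λ ¬a → ¬¬a (λ f → ¬a (f d)))
  ⟦⟧-stable (∃ᶠ x A) ρ ¬¬a = λ f → ¬¬a (λ a → a f)
  ⟦⟧-stable (⊓∀ x A) ρ ¬¬a = _
  ⟦⟧-stable (⊔∃ x A) ρ ¬¬a = ¬¬a (λ ())

  ⟦neg⟧⇒¬ : ∀ A ρ → ⟦ M ⟧ (neg A) ρ → ¬ ⟦ M ⟧ A ρ
  ⟦neg⟧⇒¬ (s ≐ t)  ρ ¬e  ¬¬e      = ¬¬e ¬e
  ⟦neg⟧⇒¬ (s ≠ t)  ρ ¬¬e ¬e       = ¬¬e ¬e
  ⟦neg⟧⇒¬ (A ∧ᶠ B) ρ na  (a , b)  = na ((λ n → ⟦neg⟧⇒¬ A ρ n a) , (λ n → ⟦neg⟧⇒¬ B ρ n b))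
  ⟦neg⟧⇒¬ (A ∨ᶠ B) ρ (na , nb) a∨b = a∨b (⟦neg⟧⇒¬ A ρ na , ⟦neg⟧⇒¬ B ρ nb)
  ⟦neg⟧⇒¬ (∀ᶠ x A) ρ na  f        = na (λ d ¬a → ⟦neg⟧⇒¬ A (update M ρ x d) ¬a (f d))
  ⟦neg⟧⇒¬ (∃ᶠ x A) ρ na  ¬f       = ¬f (λ d → ⟦neg⟧⇒¬ A (update M ρ x d) (na d))
  ⟦neg⟧⇒¬ ⊤ᶠ       ρ ()
  ⟦neg⟧⇒¬ ⊥ᶠ       ρ _   ()
  ⟦neg⟧⇒¬ (A ⊓ᶜ B) ρ ()
  ⟦neg⟧⇒¬ (A ⊔ᶜ B) ρ _   ()
  ⟦neg⟧⇒¬ (⊓∀ x A) ρ ()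
  ⟦neg⟧⇒¬ (⊔∃ x A) ρ _   ()

  ¬⇒⟦neg⟧ : ∀ A ρ → ¬ ⟦ M ⟧ A ρ → ⟦ M ⟧ (neg A) ρ
  ¬⇒⟦neg⟧ (s ≐ t)  ρ ¬a = λ e → ¬a (λ ¬e → ¬e e)
  ¬⇒⟦neg⟧ (s ≠ t)  ρ ¬a = ¬a
  ¬⇒⟦neg⟧ ⊤ᶠ       ρ ¬a = ¬a _
  ¬⇒⟦neg⟧ ⊥ᶠ       ρ ¬a = _
  ¬⇒⟦neg⟧ (A ∧ᶠ B) ρ ¬a (¬na , ¬nb) =
    ¬na (¬⇒⟦neg⟧ A ρ (λ a → ¬nb (¬⇒⟦neg⟧ B ρ (λ b → ¬a (a , b)))))
  ¬⇒⟦neg⟧ (A ∨ᶠ B) ρ ¬a =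
    ⟦⟧-stable (neg A) ρ (λ ¬na → ¬a (λ (¬a′ , _) → ¬na (¬⇒⟦neg⟧ A ρ ¬a′))) ,
    ⟦⟧-stable (neg B) ρ (λ ¬nb → ¬a (λ (_ , ¬b′) → ¬nb (¬⇒⟦neg⟧ B ρ ¬b′)))
  ¬⇒⟦neg⟧ (A ⊓ᶜ B) ρ ¬a = ¬a _
  ¬⇒⟦neg⟧ (A ⊔ᶜ B) ρ ¬a = _
  ¬⇒⟦neg⟧ (∀ᶠ x A) ρ ¬a ¬∃ =
    ¬a (λ d → ⟦⟧-stable A (update M ρ x d) (λ ¬a′ → ¬∃ d (¬⇒⟦neg⟧ A (update M ρ x d) ¬a′)))
  ¬⇒⟦neg⟧ (∃ᶠ x A) ρ ¬a = λ d → ¬⇒⟦neg⟧ A (update M ρ x d) (λ a → ¬a (λ f → f d a))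
  ¬⇒⟦neg⟧ (⊓∀ x A) ρ ¬a = ¬a _
  ¬⇒⟦neg⟧ (⊔∃ x A) ρ ¬a = _

  ⇒-intro : ∀ A B ρ → (⟦ M ⟧ A ρ → ⟦ M ⟧ B ρ) → ⟦ M ⟧ (A ⇒ᶠ B) ρ
  ⇒-intro A B ρ f (¬na , ¬b) = ¬na (¬⇒⟦neg⟧ A ρ (λ a → ¬b (f a)))

  ⇒-elim : ∀ A B ρ → ⟦ M ⟧ (A ⇒ᶠ B) ρ → ⟦ M ⟧ A ρ → ⟦ M ⟧ B ρ
  ⇒-elim A B ρ a⇒b a = ⟦⟧-stable B ρ (λ ¬b → a⇒b ((λ na → ⟦neg⟧⇒¬ A ρ na a) , ¬b))

open Semantics using (⇒-intro; ⇒-elim)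

⟦≐-refl⟧ : ∀ M ρ t → ⟦ M ⟧ (t ≐ t) ρ
⟦≐-refl⟧ M ρ t ¬refl = ¬refl refl

-- Truth is the Gödel–Gentzen translation; over decidable propositions its double
-- negations can be dropped.

¬¬≡⇔≡ : ∀ {m n : ℕ} → (¬ ¬ m ≡ n) ⇔ m ≡ n
¬¬≡⇔≡ = mk⇔ (decidable-stable (_ ≟ _)) (λ m≡n m≢n → m≢n m≡n)

¬∀¬¬¬⇔ : ∀ {A : Set} {P : A → Set} {Q : Set} → Dec Q → (∀ {a} → P a → Q) → (Q → ∃ P) →
         (¬ (∀ a → ¬ ¬ ¬ P a)) ⇔ Q
¬∀¬¬¬⇔ Q? P⇒Q Q⇒∃P = mk⇔
  (λ ¬∀ → decidable-stable Q? (λ ¬q → ¬∀ (λ a ¬¬p → ¬¬p (λ p → ¬q (P⇒Q p)))))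
  (λ q ∀¬ → let a , p = Q⇒∃P q in ∀¬ a (λ ¬p → ¬p p))

¬[¬×¬]⇔⊎ : ∀ {A B P Q : Set} → Dec P → Dec Q → A ⇔ P → B ⇔ Q → (¬ (¬ A × ¬ B)) ⇔ (P ⊎ Q)
¬[¬×¬]⇔⊎ P? Q? A⇔P B⇔Q = mk⇔
  (λ ¬[¬×¬] → decidable-stable (P? ⊎-dec Q?) λ ¬p⊎q →
     ¬[¬×¬] ((λ a → ¬p⊎q (inj₁ (to A⇔P a))) , (λ b → ¬p⊎q (inj₂ (to B⇔Q b)))))
  [ (λ p (¬a , _) → ¬a (from A⇔P p)) , (λ q (_ , ¬b) → ¬b (from B⇔Q q)) ]′

_⊨ᵉ_ : List Formula → Formula → Set₁
Γ ⊨ᵉ F = ∀ M ρ → ⟦ M ⟧ (conj (map ∥_∥ Γ)) ρ → ⟦ M ⟧ ∥ F ∥ ρ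

⊨ᵉ⇒stable : ∀ Γ F → Γ ⊨ᵉ F → Stable (Γ ∘- F)
⊨ᵉ⇒stable Γ F entails M ρ = ⇒-intro M (conj (map ∥_∥ Γ)) ∥ F ∥ ρ (entails M ρ)

ChoiceHeaded : Formula → Set
ChoiceHeaded (_ ⊓ᶜ _) = ⊤
ChoiceHeaded (_ ⊔ᶜ _) = ⊤
ChoiceHeaded (⊓∀ _ _) = ⊤
ChoiceHeaded (⊔∃ _ _) = ⊤
ChoiceHeaded _        = ⊥

surface : Formula → List (Ctx × Formula)
surface (A ∧ᶠ B) = map (map₁ (_∧ₗ B)) (surface A) ++ map (map₁ (A ∧ᵣ_)) (surface B)
surface (A ∨ᶠ B) = map (map₁ (_∨ₗ B)) (surface A) ++ map (map₁ (A ∨ᵣ_)) (surface B)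
surface (∀ᶠ x A) = map (map₁ (∀ᶜ x)) (surface A)
surface (∃ᶠ x A) = map (map₁ (∃ᶜ x)) (surface A)
surface (A ⊓ᶜ B) = (hole , A ⊓ᶜ B) ∷ []
surface (A ⊔ᶜ B) = (hole , A ⊔ᶜ B) ∷ []
surface (⊓∀ x A) = (hole , ⊓∀ x A) ∷ []
surface (⊔∃ x A) = (hole , ⊔∃ x A) ∷ []
surface _        = []

∈-surface : ∀ C E → ChoiceHeaded E → (C , E) ∈ surface (plug C E)
∈-surface hole (A ⊓ᶜ B) _ = here refl
∈-surface hole (A ⊔ᶜ B) _ = here refl
∈-surface hole (⊓∀ x A) _ = here refl
∈-surface hole (⊔∃ x A) _ = here refl
∈-surface (C ∧ₗ F) E ch = ∈-++⁺ˡ (∈-map⁺ (map₁ (_∧ₗ F)) (∈-surface C E ch))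
∈-surface (F ∧ᵣ C) E ch = ∈-++⁺ʳ _ (∈-map⁺ (map₁ (F ∧ᵣ_)) (∈-surface C E ch))
∈-surface (C ∨ₗ F) E ch = ∈-++⁺ˡ (∈-map⁺ (map₁ (_∨ₗ F)) (∈-surface C E ch))
∈-surface (F ∨ᵣ C) E ch = ∈-++⁺ʳ _ (∈-map⁺ (map₁ (F ∨ᵣ_)) (∈-surface C E ch))
∈-surface (∀ᶜ x C) E ch = ∈-map⁺ (map₁ (∀ᶜ x)) (∈-surface C E ch)
∈-surface (∃ᶜ x C) E ch = ∈-map⁺ (map₁ (∃ᶜ x)) (∈-surface C E ch)

surface-elementary : ∀ F → Elementary F → surface F ≡ []
surface-elementary (s ≐ t)  _ = refl
surface-elementary (s ≠ t)  _ = refl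
surface-elementary ⊤ᶠ       _ = refl
surface-elementary ⊥ᶠ       _ = refl
surface-elementary (A ∧ᶠ B) (eA , eB)
  rewrite surface-elementary A eA | surface-elementary B eB = refl
surface-elementary (A ∨ᶠ B) (eA , eB)
  rewrite surface-elementary A eA | surface-elementary B eB = refl
surface-elementary (∀ᶠ x A) eA rewrite surface-elementary A eA = refl
surface-elementary (∃ᶠ x A) eA rewrite surface-elementary A eA = refl

all-surface-elementary : ∀ {ℓ} {P : Ctx × Formula → Set ℓ} F → Elementary F → All P (surface F)
all-surface-elementary F eF rewrite surface-elementary F eF = []

-- The premises Wait requires for one surface occurrence in the succedent, resp. in the
-- antecedent formula between G and K; all other occurrences require none.
RightObligation : List Formula → Formula → Ctx × Formula → Set₁
RightObligation Γ F (C , H₀ ⊓ᶜ H₁) = CL12 (Γ ∘- plug C H₀) × CL12 (Γ ∘- plug C H₁)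
RightObligation Γ F (C , ⊓∀ x H)   =
  Σ Var λ y → y ∉ seqVars allVars (Γ ∘- F) × CL12 (Γ ∘- plug C (subst x (var y) H))
RightObligation Γ F _              = ⊤

LeftObligation : List Formula → List Formula → Formula → Ctx × Formula → Set₁
LeftObligation G K F (C , H₀ ⊔ᶜ H₁) =
  CL12 ((G ++ plug C H₀ ∷ K) ∘- F) × CL12 ((G ++ plug C H₁ ∷ K) ∘- F)
LeftObligation G K F (C , ⊔∃ x H)   =
  Σ Var λ y → y ∉ seqVars allVars ((G ++ plug C (⊔∃ x H) ∷ K) ∘- F) ×
              CL12 ((G ++ plug C (subst x (var y) H) ∷ K) ∘- F)
LeftObligation G K F _              = ⊤

wait-surface : ∀ Γ F → Stable (Γ ∘- F) →
  All (RightObligation Γ F) (surface F) →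
  (∀ G X K → Γ ≡ G ++ X ∷ K → All (LeftObligation G K F) (surface X)) →
  CL12 (Γ ∘- F)
wait-surface Γ F stable right left = wait Γ F stable
  (λ { C H₀ H₁ refl → lookup right (∈-surface C _ _) })
  (λ { G K C H₀ H₁ refl → lookup (left G _ K refl) (∈-surface C _ _) })
  (λ { C x H refl → lookup right (∈-surface C _ _) })
  (λ { G K C x H refl → lookup (left G _ K refl) (∈-surface C _ _) })

[]≢++∷ : ∀ (G : List Formula) {X K} → [] ≢ G ++ X ∷ K
[]≢++∷ []      ()
[]≢++∷ (_ ∷ _) ()

wait₀ : ∀ F → [] ⊨ᵉ F → All (RightObligation [] F) (surface F) → CL12 ([] ∘- F)
wait₀ F entails right = wait-surface [] F (⊨ᵉ⇒stable [] F entails) right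
  (λ G X K []≡ → ⊥-elim ([]≢++∷ G []≡))

wait₁ : ∀ X F → (X ∷ []) ⊨ᵉ F →
  All (RightObligation (X ∷ []) F) (surface F) →
  All (LeftObligation [] [] F) (surface X) →
  CL12 ((X ∷ []) ∘- F)
wait₁ X F entails right left = wait-surface (X ∷ []) F (⊨ᵉ⇒stable (X ∷ []) F entails) right split
  where
  split : ∀ G Y K → X ∷ [] ≡ G ++ Y ∷ K → All (LeftObligation G K F) (surface Y)
  split []      _ []      refl = left
  split (_ ∷ G) _ _       eq   = ⊥-elim ([]≢++∷ G (∷-injectiveʳ eq))

wait-elementary : ∀ Γ F → All Elementary Γ → Elementary F → Γ ⊨ᵉ F → CL12 (Γ ∘- F)
wait-elementary Γ F eΓ eF entails =
  wait-surface Γ F (⊨ᵉ⇒stable Γ F entails) (all-surface-elementary F eF)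
  (λ { G X K refl → all-surface-elementary X (lookup eΓ (∈-++⁺ʳ G (here refl))) })

fresh : ∀ y xs → {False (y ∈? xs)} → y ∉ xs
fresh y xs {y∉xs} = toWitnessFalse y∉xs

⊓∀-right : ∀ x H y → y ∉ allVars (⊓∀ x H) → CL12 ([] ∘- subst x (var y) H) → CL12 ([] ∘- ⊓∀ x H)
⊓∀-right x H y y∉ premise = wait₀ (⊓∀ x H) (λ _ _ _ → _) ((y , y∉ , premise) ∷ [])

∧-elimʳ : ∀ S A → Elementary S → Elementary A → CL12 (((S ∧ᶠ A) ∷ []) ∘- A)
∧-elimʳ S A eS eA = wait-elementary _ A ((eS , eA) ∷ []) eA (λ _ _ (_ , a) → a)

-- Variables: x = 0, y = 1; 2–6 are bound inside lenBound.
x≐y0 x≐y1 : Formula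
x≐y0 = var 0 ≐ (var 1 ·0)
x≐y1 = var 0 ≐ (var 1 ·1)

halves : Formula
halves = x≐y0 ⊔ᶜ x≐y1

-- Correct only when variable 5 occurs in neither a nor b.
_≤ᶠ_ : Term → Term → Formula
a ≤ᶠ b = ∃ᶠ 5 ((a ⊕ var 5) ≐ b)

p≐e·d d≐1∨2∣d : Formula
p≐e·d     = var 2 ≐ (var 4 ⊗ var 3)
d≐1∨2∣d = (var 3 ≐ sc zer) ∨ᶠ ∃ᶠ 6 (var 3 ≐ (var 6 ⊗ two))

isPowerOf2 : Formula
isPowerOf2 = ∀ᶠ 3 (∀ᶠ 4 (p≐e·d ⇒ᶠ d≐1∨2∣d))

p≤x∨y<p : Formula
p≤x∨y<p = (var 2 ≤ᶠ var 0) ∨ᶠ (sc (var 1) ≤ᶠ var 2)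

noPowerOf2Between : Formula
noPowerOf2Between = ∀ᶠ 2 (isPowerOf2 ⇒ᶠ p≤x∨y<p)

-- The first two disjuncts are redundant in ℕ, but they make the instances used in the
-- induction steps logically valid.
lenBound : Formula
lenBound = x≐y0 ∨ᶠ (x≐y1 ∨ᶠ noPowerOf2Between)

halving : Formula
halving = ⊔∃ 1 (lenBound ∧ᶠ halves)

⟦≤ᶠ⟧⇔ : ∀ {m n} → (¬ (∀ k → ¬ ¬ ¬ m + k ≡ n)) ⇔ m ≤ n
⟦≤ᶠ⟧⇔ {m} = ¬∀¬¬¬⇔ (_ ≤? _)
  (λ {k} m+k≡n → transport (m ≤_) m+k≡n (m≤m+n m k)) (λ m≤n → m≤n⇒∃[o]m+o≡n m≤n)

module _ (ρ : Var → ℕ) where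

  ⟦isPowerOf2⟧⇔ : ∀ n →
    ⟦ ℕ-model ⟧ isPowerOf2 (update ℕ-model ρ 2 n) ⇔ DivisorsAre1OrMultiplesOf 2 n
  ⟦isPowerOf2⟧⇔ n = mk⇔
    (λ h {d} (divides e n≡ed) →
       to (disj⇔ d e) (⇒-elim ℕ-model p≐e·d d≐1∨2∣d (env d e) (h d e) (λ n≢ed → n≢ed n≡ed)))
    (λ divs d e → ⇒-intro ℕ-model p≐e·d d≐1∨2∣d (env d e) λ ¬¬n≡ed →
       from (disj⇔ d e) (divs (divides e (to ¬¬≡⇔≡ ¬¬n≡ed))))
    where
    env : ℕ → ℕ → Var → ℕ
    env d e = update ℕ-model (update ℕ-model (update ℕ-model ρ 2 n) 3 d) 4 e
    disj⇔ : ∀ d e → ⟦ ℕ-model ⟧ d≐1∨2∣d (env d e) ⇔ (d ≡ 1 ⊎ 2 ∣ d)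
    disj⇔ d e = ¬[¬×¬]⇔⊎ (d ≟ 1) (2 ∣? d) ¬¬≡⇔≡
      (¬∀¬¬¬⇔ (2 ∣? d) (λ {q} → divides q) (λ (divides q d≡q*2) → q , d≡q*2))

  ⟦noPowerOf2Between⟧⇔ : ⟦ ℕ-model ⟧ noPowerOf2Between ρ ⇔
    (∀ p → DivisorsAre1OrMultiplesOf 2 p → p ≤ ρ 0 ⊎ suc (ρ 1) ≤ p)
  ⟦noPowerOf2Between⟧⇔ = mk⇔
    (λ h p (divs : DivisorsAre1OrMultiplesOf 2 p) → to (disj⇔ p)
       (⇒-elim ℕ-model isPowerOf2 p≤x∨y<p (env p) (h p) (from (⟦isPowerOf2⟧⇔ p) divs)))
    (λ avoid p → ⇒-intro ℕ-model isPowerOf2 p≤x∨y<p (env p) λ isPow →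
       from (disj⇔ p) (avoid p (to (⟦isPowerOf2⟧⇔ p) isPow)))
    where
    env : ℕ → Var → ℕ
    env = update ℕ-model ρ 2
    disj⇔ : ∀ p → ⟦ ℕ-model ⟧ p≤x∨y<p (env p) ⇔ (p ≤ ρ 0 ⊎ suc (ρ 1) ≤ p)
    disj⇔ p = ¬[¬×¬]⇔⊎ (_ ≤? _) (_ ≤? _) ⟦≤ᶠ⟧⇔ ⟦≤ᶠ⟧⇔

  ⟦lenBound⟧⇔ : ⟦ ℕ-model ⟧ lenBound ρ ⇔ len (ρ 1) ≤ len (ρ 0)
  ⟦lenBound⟧⇔ = mk⇔
    (λ h → decidable-stable (_ ≤? _) λ ∣y∣≰∣x∣ → h
      ( (λ ¬¬x≡2y → ¬¬x≡2y λ x≡2y → ∣y∣≰∣x∣ (len-mono (transport (ρ 1 ≤_) (sym x≡2y) y≤2y)))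
      , (λ ¬[¬×¬] → ¬[¬×¬]
          ( (λ ¬¬x≡2y+1 → ¬¬x≡2y+1 λ x≡2y+1 →
               ∣y∣≰∣x∣ (len-mono (transport (ρ 1 ≤_) (sym x≡2y+1) (m≤n⇒m≤1+n y≤2y))))
          , (λ noPow → ∣y∣≰∣x∣ (from ∣y∣≤∣x∣⇔ (to ⟦noPowerOf2Between⟧⇔ noPow)))))))
    (λ ∣y∣≤∣x∣ (_ , ¬[¬×¬]) → ¬[¬×¬] λ (_ , ¬noPow) →
       ¬noPow (from ⟦noPowerOf2Between⟧⇔ (to ∣y∣≤∣x∣⇔ ∣y∣≤∣x∣)))
    where
    ∣y∣≤∣x∣⇔ = len≤len⇔noPowerOf2Between (ρ 0) (ρ 1)
    y≤2y : ρ 1 ≤ 2 * ρ 1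
    y≤2y = m≤m+n (ρ 1) (ρ 1 + 0)

lenBound-sizebound : SizeBound 1 lenBound
lenBound-sizebound = _ , var 0 , fresh 1 _ , λ ρ → to (⟦lenBound⟧⇔ ρ) , from (⟦lenBound⟧⇔ ρ)

halving-polyBounded : PolyBounded halving
halving-polyBounded =
  pb-⊔x 1 _ lenBound halves refl lenBound-sizebound (pb-⊔ (pb-eq _ _) (pb-eq _ _))

base : CL12 ((∀ᶠ 0 ((var 0 ⊗ zer) ≐ zer) ∷ []) ∘- subst 0 zer halving)
base = ⊔x-choose _ hole 1 _ zer (inj₁ refl) (⊔-choose _ (_ ∧ᵣ hole) _ _ false
  (wait-elementary _ _ (_ ∷ []) _ λ M ρ 2·0≐0 →
    let 0≐2·0 = λ ¬eq → 2·0≐0 _ (λ eq → ¬eq (sym eq)) in (λ (¬0≐2·0 , _) → ¬0≐2·0 0≐2·0) , 0≐2·0))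

neg-halving-∨-valid : ∀ x y R → Elementary R → Valid ∥ R ∥ →
  y ∉ allVars (subst 0 (var x) (neg halving) ∨ᶠ R) →
  CL12 ([] ∘- (subst 0 (var x) (neg halving) ∨ᶠ R))
neg-halving-∨-valid x y R eR valid y∉ =
  wait₀ (subst 0 (var x) (neg halving) ∨ᶠ R) (λ _ _ _ (¬⊤ , _) → ¬⊤ _)
    ((y , y∉ , refute-halves) ∷ map⁺ (all-surface-elementary R eR))
  where
  instantiate : Formula → Formula
  instantiate = subst 1 (var y) ∘ subst 0 (var x)

  refute-halves : CL12 ([] ∘- ((instantiate (neg lenBound) ∨ᶠ instantiate (neg halves)) ∨ᶠ R))
  refute-halves = wait₀ _ (λ _ _ _ (¬[N∨⊤] , _) → ¬[N∨⊤] λ (_ , ¬⊤) → ¬⊤ _)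
    ((finish _ _ _ _ , finish _ _ _ _) ∷ map⁺ (all-surface-elementary R eR))
    where
    finish : ∀ N A → Elementary N → Elementary A → CL12 ([] ∘- ((N ∨ᶠ A) ∨ᶠ R))
    finish N A eN eA = wait-elementary [] _ [] ((eN , eA) , eR) (λ M ρ _ (_ , ¬r) → ¬r (valid M ρ))

step₀ : CL12 ([] ∘- ⊓-closure (halving ⇒ᶠ subst 0 (var 0 ·0) halving))
step₀ = ⊓∀-right 0 _ 10 (fresh 10 _)
  (⊔x-choose [] (_ ∨ᵣ hole) 1 _ (var 10) (inj₂ (10 , refl , fresh 10 _))
    (⊔-choose [] (_ ∨ᵣ (_ ∧ᵣ hole)) _ _ false
      (neg-halving-∨-valid 10 11 _ _
        (λ M ρ → (λ (¬x0≐x0 , _) → ¬x0≐x0 (⟦≐-refl⟧ M ρ (var 10 ·0)))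
               , ⟦≐-refl⟧ M ρ (var 10 ·0))
        (fresh 11 _))))

step₁ : CL12 ([] ∘- ⊓-closure (halving ⇒ᶠ subst 0 (var 0 ·1) halving))
step₁ = ⊓∀-right 0 _ 10 (fresh 10 _)
  (⊔x-choose [] (_ ∨ᵣ hole) 1 _ (var 10) (inj₂ (10 , refl , fresh 10 _))
    (⊔-choose [] (_ ∨ᵣ (_ ∧ᵣ hole)) _ _ true
      (neg-halving-∨-valid 10 11 _ _
        (λ M ρ → (λ (_ , ¬rest) → ¬rest λ (¬x1≐x1 , _) → ¬x1≐x1 (⟦≐-refl⟧ M ρ (var 10 ·1)))
               , ⟦≐-refl⟧ M ρ (var 10 ·1))
        (fresh 11 _))))

halving-everywhere : CLA4⊢ (⊓∀ 0 halving)
halving-everywhere = cla4-induction 0 halving halving-polyBounded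
  (logical-consequence (_ ∷ []) _ (axiom ax5 ∷ []) refl base)
  (logical-consequence [] _ [] refl step₀)
  (logical-consequence [] _ [] refl step₁)

halving⇒halves : CL12 ((⊓∀ 0 halving ∷ []) ∘- ⊓∀ 0 (⊔∃ 1 halves))
halving⇒halves = wait₁ _ _ (λ _ _ _ → _) ((20 , fresh 20 _ , instantiate-x) ∷ []) (_ ∷ [])
  where
  S H₀ H₁ : Formula
  S  = subst 1 (var 21) (subst 0 (var 20) lenBound)
  H₀ = subst 1 (var 21) (subst 0 (var 20) x≐y0)
  H₁ = subst 1 (var 21) (subst 0 (var 20) x≐y1)

  choose-disjunct : CL12 (((S ∧ᶠ (H₀ ⊔ᶜ H₁)) ∷ []) ∘- (H₀ ⊔ᶜ H₁))
  choose-disjunct = wait₁ _ _ (λ { _ _ (_ , ()) }) (_ ∷ [])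
    ( ( ⊔-choose _ hole H₀ H₁ false (∧-elimʳ S H₀ _ _)
      , ⊔-choose _ hole H₀ H₁ true  (∧-elimʳ S H₁ _ _))
    ∷ [])

  obtain-y : CL12 ((subst 0 (var 20) halving ∷ []) ∘- ⊔∃ 1 (subst 0 (var 20) halves))
  obtain-y = wait₁ _ _ (λ { _ _ () }) (_ ∷ [])
    ( (21 , fresh 21 _ ,
       ⊔x-choose _ hole 1 _ (var 21) (inj₂ (21 , refl , fresh 21 _)) choose-disjunct)
    ∷ [])

  instantiate-x : CL12 ((⊓∀ 0 halving ∷ []) ∘- ⊔∃ 1 (subst 0 (var 20) halves))
  instantiate-x =
    ⊓x-choose [] [] hole 0 halving (var 20) _ (inj₂ (20 , refl , fresh 20 _)) obtain-y

fact12p2 : CLA4⊢ (⊓∀ 0 (⊔∃ 1 ((var 0 ≐ (var 1 ·0)) ⊔ᶜ (var 0 ≐ (var 1 ·1)))))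
fact12p2 = logical-consequence (⊓∀ 0 halving ∷ []) _ (halving-everywhere ∷ []) refl halving⇒halves
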